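{- Let $i\ge 7$ and let $S$ be a substring of $F_i$. If $F_{i-2}\,Q_i$ is a proper substring of $S$, then $S$ occurs exactly once in $F_i$.
   Context: Fibonacci words: $F_1=\texttt{b}$, $F_2=\texttt{a}$, $F_k=F_{k-1}F_{k-2}$ for $k\ge 3$. For $i\ge 7$, $Q_i:=F_{i-5}F_{i-6}\cdots F_3F_2$. A proper substring of $S$ is a substring different from $S$. -}

module Defs where

open import Data.Nat using (ℕ; zero; suc; _∸_; _≤_; _<_)
open import Data.List using (List; []; _∷_; _++_; length; take; drop)
open import Data.Product using (Σ; ∃; _×_; _,_)
open import Relation.Binary.PropositionalEquality using (_≡_)
open import Relation.Nullary using (¬_)

data Letter : Set where
  a b : Letter

Word : Set
Word = List Letter

-- Fibonacci words: F 1 = b, F 2 = a, F k = F (k-1) ++ F (k-2) for k ≥ 3.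
-- F 0 is an unused dummy value (empty word).
F : ℕ → Word
F zero = []
F (suc zero) = b ∷ []
F (suc (suc zero)) = a ∷ []
F (suc (suc (suc k))) = F (suc (suc k)) ++ F (suc k)

Desc : ℕ → Word
Desc zero = []
Desc (suc zero) = []
Desc (suc (suc n)) = F (suc (suc n)) ++ Desc (suc n)

-- Q i = F (i-5) F (i-6) ... F 3 F 2   (used for i ≥ 7)
Q : ℕ → Word
Q i = Desc (i ∸ 5)

IsSubstring : Word → Word → Set
IsSubstring S T = Σ Word λ u → Σ Word λ v → u ++ (S ++ v) ≡ T

IsProperSubstring : Word → Word → Set
IsProperSubstring S T = IsSubstring S T × ¬ (S ≡ T)

OccursAt : Word → Word → ℕ → Set
OccursAt S T p = (length S ≤ length (drop p T)) × (take (length S) (drop p T) ≡ S)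

OccursExactlyOnce : Word → Word → Set
OccursExactlyOnce S T = Σ ℕ λ p → OccursAt S T p × (∀ q → OccursAt S T q → q ≡ p)

-- Write D_n = F_n F_{n-1} ⋯ F_2 (Desc n), so that F_{i-2} Q_i = D_{i-3}.  The Fibonacci
-- morphism φ : a ↦ ab, b ↦ a satisfies φ(F_n) = F_{n+1} and φ(D_n) a = D_{n+1}, and an
-- image φ(w) can be cut uniquely before each a; hence every occurrence of D_{n+1} in F_{n+4}
-- comes from an occurrence of D_n in F_{n+3}, and by induction from F_7 the word D_{i-3}
-- occurs in F_i only at positions 0 and |F_{i-2}|.  Since F_{n+1} F_n and F_n F_{n+1} differ
-- exactly in their last two letters, these two occurrences are followed by different letters.
-- Two occurrences of a word properly containing D_{i-3} would therefore put its copy of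
-- D_{i-3} twice at the same position, or at both positions followed by the same letter.
module Submission where

open import Defs
open import Data.Nat using (ℕ; zero; suc; _+_; _≤_; _∸_; s≤s; z≤n)
open import Data.List using (List; []; _∷_; _++_; length; take; drop)
open import Data.List.Properties
  using (∷-injectiveˡ; ∷-injectiveʳ; ++-assoc; ++-identityʳ; ++-cancelˡ; ++-cancelʳ;
         ++-conicalˡ; ++-conicalʳ; length-++-≤ˡ; take++drop≡id)
open import Data.Product using (Σ-syntax; _×_; _,_)
open import Data.Sum using (_⊎_; inj₁; inj₂)
open import Data.Empty using (⊥; ⊥-elim)
open import Function using (_∘_)
open import Relation.Nullary using (contradiction)
open import Relation.Binary.PropositionalEquality
  using (_≡_; _≢_; refl; sym; trans; cong; cong₂; subst; module ≡-Reasoning)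

drop-length-++ : ∀ {A : Set} (xs ys : List A) → drop (length xs) (xs ++ ys) ≡ ys
drop-length-++ []       ys = refl
drop-length-++ (x ∷ xs) ys = drop-length-++ xs ys

take-length-++ : ∀ {A : Set} (xs ys : List A) → take (length xs) (xs ++ ys) ≡ xs
take-length-++ []       ys = refl
take-length-++ (x ∷ xs) ys = cong (x ∷_) (take-length-++ xs ys)

++-reassoc : ∀ {A : Set} (x u D v y : List A) →
  x ++ ((u ++ (D ++ v)) ++ y) ≡ (x ++ u) ++ (D ++ (v ++ y))
++-reassoc x u D v y = begin
  x ++ ((u ++ (D ++ v)) ++ y)  ≡⟨ cong (x ++_) (++-assoc u (D ++ v) y) ⟩
  x ++ (u ++ ((D ++ v) ++ y))  ≡⟨ cong (λ z → x ++ (u ++ z)) (++-assoc D v y) ⟩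
  x ++ (u ++ (D ++ (v ++ y)))  ≡⟨ ++-assoc x u _ ⟨
  (x ++ u) ++ (D ++ (v ++ y))  ∎
  where open ≡-Reasoning

occursAt-++ : ∀ x S y → OccursAt S (x ++ (S ++ y)) (length x)
occursAt-++ x S y rewrite drop-length-++ x (S ++ y) = length-++-≤ˡ S , take-length-++ S y

-- The hypothesis S ≢ [] is needed: [] occurs at every p, even past the end of T.
occursAt⇒++ : ∀ {S} T p → S ≢ [] → OccursAt S T p →
  Σ[ x ∈ Word ] Σ[ y ∈ Word ] x ++ (S ++ y) ≡ T × length x ≡ p
occursAt⇒++ {S} T zero _ (_ , take≡S) = [] , drop (length S) T , S++rest≡T , refl
  where
  S++rest≡T : S ++ drop (length S) T ≡ T
  S++rest≡T = trans (cong (_++ drop (length S) T) (sym take≡S)) (take++drop≡id (length S) T)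
occursAt⇒++ {[]}    []      (suc p) S≢[] _ = contradiction refl S≢[]
occursAt⇒++ {_ ∷ _} []      (suc p) _ (() , _)
occursAt⇒++         (t ∷ T) (suc p) S≢[] occ with occursAt⇒++ T p S≢[] occ
... | x , y , refl , refl = t ∷ x , y , refl , refl

module _ {D X T : Word}
  (D-occurrences : ∀ {x y} → x ++ (D ++ y) ≡ T → x ≡ [] ⊎ x ≡ X)
  (followers-differ : ∀ {c r r′} → D ++ c ∷ r ≡ T → X ++ (D ++ c ∷ r′) ≡ T → ⊥)
  where

  private
    shift : ∀ x u v y → x ++ ((u ++ (D ++ v)) ++ y) ≡ T → (x ++ u) ++ (D ++ (v ++ y)) ≡ T
    shift x u v y = trans (sym (++-reassoc x u D v y))

    followed-at-both-occurrences : ∀ v y₁ y₂ → D ≢ D ++ v →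
      D ++ (v ++ y₁) ≡ T → X ++ (D ++ (v ++ y₂)) ≡ T → ⊥
    followed-at-both-occurrences []      _ _ D≢D++[] _ _ = D≢D++[] (sym (++-identityʳ D))
    followed-at-both-occurrences (_ ∷ _) _ _ _ occ₀ occ₁ = followers-differ occ₀ occ₁

    at-both-occurrences : ∀ u v x₁ y₁ x₂ y₂ → D ≢ u ++ (D ++ v) →
      x₁ ++ u ≡ [] → x₂ ++ u ≡ X →
      x₁ ++ ((u ++ (D ++ v)) ++ y₁) ≡ T → x₂ ++ ((u ++ (D ++ v)) ++ y₂) ≡ T → ⊥
    at-both-occurrences u v x₁ y₁ x₂ y₂ D≢S p q occ₁ occ₂
      with ++-conicalˡ x₁ u p | ++-conicalʳ x₁ u p
    ... | refl | refl = followed-at-both-occurrences v y₁ y₂ D≢S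
      (shift [] [] v y₁ occ₁) (subst (λ z → z ++ _ ≡ T) q (shift x₂ [] v y₂ occ₂))

  proper-superword-occurrence-unique : ∀ {S} x₁ y₁ x₂ y₂ → IsProperSubstring D S →
    x₁ ++ (S ++ y₁) ≡ T → x₂ ++ (S ++ y₂) ≡ T → x₁ ≡ x₂
  proper-superword-occurrence-unique x₁ y₁ x₂ y₂ ((u , v , refl) , D≢S) occ₁ occ₂
    with D-occurrences (shift x₁ u v y₁ occ₁) | D-occurrences (shift x₂ u v y₂ occ₂)
  ... | inj₁ p | inj₁ q = ++-cancelʳ u x₁ x₂ (trans p (sym q))
  ... | inj₂ p | inj₂ q = ++-cancelʳ u x₁ x₂ (trans p (sym q))
  ... | inj₁ p | inj₂ q = ⊥-elim (at-both-occurrences u v x₁ y₁ x₂ y₂ D≢S p q occ₁ occ₂)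
  ... | inj₂ p | inj₁ q = ⊥-elim (at-both-occurrences u v x₂ y₂ x₁ y₁ D≢S q p occ₂ occ₁)

φ : Word → Word
φ []      = []
φ (a ∷ w) = a ∷ b ∷ φ w
φ (b ∷ w) = a ∷ φ w

φ-++ : ∀ u w → φ (u ++ w) ≡ φ u ++ φ w
φ-++ []      w = refl
φ-++ (a ∷ u) w = cong (λ z → a ∷ b ∷ z) (φ-++ u w)
φ-++ (b ∷ u) w = cong (a ∷_) (φ-++ u w)

φ-F : ∀ n → φ (F (suc n)) ≡ F (2 + n)
φ-F zero          = refl
φ-F (suc zero)    = refl
φ-F (suc (suc n)) = trans (φ-++ (F (2 + n)) (F (1 + n))) (cong₂ _++_ (φ-F (suc n)) (φ-F n))

φ-Desc : ∀ n y → φ (Desc (1 + n)) ++ a ∷ y ≡ Desc (2 + n) ++ y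
φ-Desc zero    y = refl
φ-Desc (suc n) y = begin
  φ (F (2 + n) ++ Desc (1 + n)) ++ a ∷ y        ≡⟨ cong (_++ a ∷ y) (φ-++ (F (2 + n)) _) ⟩
  (φ (F (2 + n)) ++ φ (Desc (1 + n))) ++ a ∷ y  ≡⟨ ++-assoc (φ (F (2 + n))) _ _ ⟩
  φ (F (2 + n)) ++ (φ (Desc (1 + n)) ++ a ∷ y)  ≡⟨ cong₂ _++_ (φ-F (1 + n)) (φ-Desc n y) ⟩
  F (3 + n) ++ (Desc (2 + n) ++ y)              ≡⟨ ++-assoc (F (3 + n)) _ _ ⟨
  Desc (3 + n) ++ y                             ∎
  where open ≡-Reasoning

φ-prefix : ∀ u y w → φ u ++ a ∷ y ≡ φ w → Σ[ w′ ∈ Word ] u ++ w′ ≡ w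
φ-prefix []      y w eq = w , refl
φ-prefix (a ∷ u) y (a ∷ w) eq with φ-prefix u y w (∷-injectiveʳ (∷-injectiveʳ eq))
... | w′ , refl = w′ , refl
φ-prefix (b ∷ u) y (b ∷ w) eq with φ-prefix u y w (∷-injectiveʳ eq)
... | w′ , refl = w′ , refl
φ-prefix (a ∷ u)     y []          ()
φ-prefix (a ∷ u)     y (b ∷ [])    ()
φ-prefix (a ∷ u)     y (b ∷ a ∷ w) ()
φ-prefix (a ∷ u)     y (b ∷ b ∷ w) ()
φ-prefix (b ∷ u)     y []          ()
φ-prefix (b ∷ [])    y (a ∷ w)     ()
φ-prefix (b ∷ a ∷ u) y (a ∷ w)     ()
φ-prefix (b ∷ b ∷ u) y (a ∷ w)     ()

φ-desubstitute : ∀ x u y w → x ++ (φ u ++ a ∷ y) ≡ φ w →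
  Σ[ w₁ ∈ Word ] Σ[ w₂ ∈ Word ] w₁ ++ (u ++ w₂) ≡ w × φ w₁ ≡ x
φ-desubstitute [] u y w eq with φ-prefix u y w eq
... | w₂ , eq₂ = [] , w₂ , eq₂ , refl
φ-desubstitute (a ∷ b ∷ x) u y (a ∷ w) eq
  with φ-desubstitute x u y w (∷-injectiveʳ (∷-injectiveʳ eq))
... | w₁ , w₂ , refl , refl = a ∷ w₁ , w₂ , refl , refl
φ-desubstitute (a ∷ x) u y (b ∷ w) eq with φ-desubstitute x u y w (∷-injectiveʳ eq)
... | w₁ , w₂ , refl , refl = b ∷ w₁ , w₂ , refl , refl
φ-desubstitute (a ∷ x)     u       y []      ()
φ-desubstitute (a ∷ a ∷ x) u       y (a ∷ w) ()
φ-desubstitute (a ∷ [])    []      y (a ∷ w) ()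
φ-desubstitute (a ∷ [])    (a ∷ u) y (a ∷ w) ()
φ-desubstitute (a ∷ [])    (b ∷ u) y (a ∷ w) ()
φ-desubstitute (b ∷ x)     u       y []      ()
φ-desubstitute (b ∷ x)     u       y (a ∷ w) ()
φ-desubstitute (b ∷ x)     u       y (b ∷ w) ()

Desc4-occurrences-in-F7 : ∀ x y → x ++ (Desc 4 ++ y) ≡ F 7 → x ≡ [] ⊎ x ≡ F 5
Desc4-occurrences-in-F7 x y occ =
  subst (λ x → x ≡ [] ⊎ x ≡ F 5) x≡prefix (at (length x) suffix≡)
  where
  suffix≡ : drop (length x) (F 7) ≡ Desc 4 ++ y
  suffix≡ = trans (cong (drop (length x)) (sym occ)) (drop-length-++ x _)
  x≡prefix : take (length x) (F 7) ≡ x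
  x≡prefix = trans (cong (take (length x)) (sym occ)) (take-length-++ x _)
  at : ∀ n → drop n (F 7) ≡ Desc 4 ++ y → take n (F 7) ≡ [] ⊎ take n (F 7) ≡ F 5
  at 0  _ = inj₁ refl
  at 5  _ = inj₂ refl
  at 1  ()
  at 2  ()
  at 3  ()
  at 4  ()
  at 6  ()
  at 7  ()
  at 8  ()
  at 9  ()
  at 10 ()
  at 11 ()
  at 12 ()
  at 13 ()
  at (suc (suc (suc (suc (suc (suc (suc (suc (suc (suc (suc (suc (suc (suc _)))))))))))))) ()

Desc-occurrences : ∀ k x y → x ++ (Desc (4 + k) ++ y) ≡ F (7 + k) → x ≡ [] ⊎ x ≡ F (5 + k)
Desc-occurrences zero x y occ = Desc4-occurrences-in-F7 x y occ
Desc-occurrences (suc k) x y occ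
  with φ-desubstitute x (Desc (4 + k)) y (F (7 + k))
         (trans (cong (x ++_) (φ-Desc (3 + k) y)) (trans occ (sym (φ-F (6 + k)))))
... | w₁ , w₂ , occ′ , refl with Desc-occurrences k w₁ w₂ occ′
...   | inj₁ refl = inj₁ refl
...   | inj₂ refl = inj₂ (φ-F (4 + k))

F-almost-commute : ∀ n → Σ[ x ∈ Letter ] Σ[ y ∈ Letter ] x ≢ y ×
  F (3 + n) ≡ Desc (1 + n) ++ x ∷ y ∷ [] × F (1 + n) ++ F (2 + n) ≡ Desc (1 + n) ++ y ∷ x ∷ []
F-almost-commute zero = a , b , (λ ()) , refl , refl
F-almost-commute (suc n) with F-almost-commute n
... | x , y , x≢y , Fxy , Fyx = y , x , x≢y ∘ sym , F4≡ , F2F3≡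
  where
  open ≡-Reasoning
  F4≡ : F (4 + n) ≡ Desc (2 + n) ++ y ∷ x ∷ []
  F4≡ = begin
    (F (2 + n) ++ F (1 + n)) ++ F (2 + n)      ≡⟨ ++-assoc (F (2 + n)) _ _ ⟩
    F (2 + n) ++ (F (1 + n) ++ F (2 + n))      ≡⟨ cong (F (2 + n) ++_) Fyx ⟩
    F (2 + n) ++ (Desc (1 + n) ++ y ∷ x ∷ [])  ≡⟨ ++-assoc (F (2 + n)) _ _ ⟨
    Desc (2 + n) ++ y ∷ x ∷ []                 ∎
  F2F3≡ : F (2 + n) ++ F (3 + n) ≡ Desc (2 + n) ++ x ∷ y ∷ []
  F2F3≡ = trans (cong (F (2 + n) ++_) Fxy) (sym (++-assoc (F (2 + n)) _ _))

Desc-followers-differ : ∀ n {c r r′} → Desc (1 + n) ++ c ∷ r ≡ F (4 + n) →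
  F (2 + n) ++ (Desc (1 + n) ++ c ∷ r′) ≡ F (4 + n) → ⊥
Desc-followers-differ n {c} {r} {r′} occ₀ occ₁ with F-almost-commute n
... | x , y , x≢y , Fxy , Fyx = x≢y (trans (sym c≡x) c≡y)
  where
  open ≡-Reasoning
  c≡x : c ≡ x
  c≡x = ∷-injectiveˡ (++-cancelˡ (Desc (1 + n)) _ _ (begin
    Desc (1 + n) ++ c ∷ r                     ≡⟨ occ₀ ⟩
    F (3 + n) ++ F (2 + n)                    ≡⟨ cong (_++ F (2 + n)) Fxy ⟩
    (Desc (1 + n) ++ x ∷ y ∷ []) ++ F (2 + n) ≡⟨ ++-assoc (Desc (1 + n)) _ _ ⟩
    Desc (1 + n) ++ x ∷ y ∷ F (2 + n)         ∎))
  c≡y : c ≡ y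
  c≡y = ∷-injectiveˡ (++-cancelˡ (Desc (1 + n)) _ _ (++-cancelˡ (F (2 + n)) _ _ (begin
    F (2 + n) ++ (Desc (1 + n) ++ c ∷ r′)      ≡⟨ occ₁ ⟩
    (F (2 + n) ++ F (1 + n)) ++ F (2 + n)      ≡⟨ ++-assoc (F (2 + n)) _ _ ⟩
    F (2 + n) ++ (F (1 + n) ++ F (2 + n))      ≡⟨ cong (F (2 + n) ++_) Fyx ⟩
    F (2 + n) ++ (Desc (1 + n) ++ y ∷ x ∷ [])  ∎)))

F-nonempty : ∀ n → F (suc n) ≢ []
F-nonempty zero          ()
F-nonempty (suc zero)    ()
F-nonempty (suc (suc n)) = F-nonempty (suc n) ∘ ++-conicalˡ (F (2 + n)) (F (1 + n))

F-++-Desc : ∀ n → F (4 + n) ++ Desc (1 + n) ≡ Desc (3 + n)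
F-++-Desc n = ++-assoc (F (3 + n)) (F (2 + n)) (Desc (1 + n))

lemma27 : (i : ℕ) → 7 ≤ i → (S : Word) → IsSubstring S (F i) →
    IsProperSubstring (F (i ∸ 2) ++ Q i) S → OccursExactlyOnce S (F i)
lemma27 _ (s≤s (s≤s (s≤s (s≤s (s≤s (s≤s (s≤s (z≤n {k})))))))) S (x , y , occ) P⊏S =
  length x , subst (λ T → OccursAt S T (length x)) occ (occursAt-++ x S y) , unique
  where
  D⊏S : IsProperSubstring (Desc (4 + k)) S
  D⊏S = subst (λ D → IsProperSubstring D S) (F-++-Desc (1 + k)) P⊏S
  S≢[] : S ≢ []
  S≢[] with D⊏S
  ... | (u , v , refl) , _ =
    F-nonempty (3 + k) ∘ ++-conicalˡ _ _ ∘ ++-conicalˡ _ v ∘ ++-conicalʳ u _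
  unique : ∀ q → OccursAt S (F (7 + k)) q → q ≡ length x
  unique q occ-q with occursAt⇒++ (F (7 + k)) q S≢[] occ-q
  ... | x′ , y′ , occ′ , refl = cong length
    (proper-superword-occurrence-unique (Desc-occurrences k _ _) (Desc-followers-differ (3 + k))
      x′ y′ x y D⊏S occ′ occ)
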